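{- Let $n\geq 4$ be an even integer. Then ${_nG_n}(-1)=0$ for infinitely many primes $p$ with $p\equiv 3\pmod 4$.
   Context: $\Gamma_p$ is Morita's $p$-adic gamma function; $\omega$ is the Teichmüller character of $\mathbb{F}_p^\times$ ($\omega(a)\equiv a\pmod p$), $\overline{\omega}$ its inverse, and every multiplicative character (including the trivial one) takes value $0$ at $0$. $\langle x\rangle$ denotes the fractional part and $\lfloor x\rfloor$ the floor of $x\in\mathbb{Q}$. For $a_k,b_k\in\mathbb{Q}\cap\mathbb{Z}_p$ and $t\in\mathbb{F}_p$, $${_n\mathbb{G}_n}\left[\begin{array}{ccc}a_1,&\ldots,&a_n\\ b_1,&\ldots,&b_n\end{array}\Big| t\right]:=\frac{ -1}{p-1}\sum_{a=0}^{p-2}(-1)^{an}\,\overline{\omega}^a(t)\prod_{k=1}^n(-p)^{ -\lfloor\langle a_k\rangle-\frac{a}{p-1}\rfloor-\lfloor\langle -b_k\rangle+\frac{a}{p-1}\rfloor}\frac{\Gamma_p(\langle a_k-\frac{a}{p-1}\rangle)}{\Gamma_p(\langle a_k\rangle)}\frac{\Gamma_p(\langle -b_k+\frac{a}{p-1}\rangle)}{\Gamma_p(\langle -b_k\rangle)},$$ and, for primes $p\nmid n$, ${_nG_n}(t):={_n\mathbb{G}_n}\left[\begin{array}{cccc}\frac{1}{2n},&\frac{3}{2n},&\ldots,&\frac{2n-1}{2n}\\ 0,&\frac1n,&\ldots,&\frac{n-1}{n}\end{array}\Big| t\right]$; here $-1$ is viewed as an element of $\mathbb{F}_p$. -}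

module Defs where

open import Data.Bool using (if_then_else_)
open import Data.Nat as ℕ using (ℕ; zero; suc; _∸_)
open import Data.Nat.Divisibility using (_∣?_)
open import Data.Integer as ℤ using (ℤ; +_; ∣_∣)
open import Data.Integer.Divisibility as ℤDiv using ()
open import Data.Rational as ℚ using (ℚ; ↥_; ↧_; floor)
open import Data.List using (List; _∷_; []; map; foldr; upTo)
open import Data.Product using (_×_; _,_)
open import Relation.Nullary.Decidable using (does)

sumℤ : List ℤ → ℤ
sumℤ = foldr ℤ._+_ (+ 0)

prodℤ : List ℤ → ℤ
prodℤ = foldr ℤ._*_ (+ 1)

sumℕ : List ℕ → ℕ
sumℕ = foldr ℕ._+_ 0

sgn : ℕ → ℤ
sgn zero    = + 1
sgn (suc m) = ℤ.- sgn m

sgnℤ : ℤ → ℤ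
sgnℤ e = sgn ∣ e ∣

-- the rational a/d (d ≥ 1 in all uses; 0 if d = 0)
divℕ : ℕ → ℕ → ℚ
divℕ a zero    = ℚ.0ℚ
divℕ a (suc d) = (+ a) ℚ./ suc d

fract : ℚ → ℚ
fract q = q ℚ.- (floor q ℚ./ 1)

-- Elements of ℤ_p are handled through their reductions mod p^k for every k;
-- an element of ℤ_p is 0 iff p^k divides its representative for all k.

invMod : ℕ → ℕ → ℤ → ℤ
invMod p k u = u ℤ.^ (p ℕ.^ k ℕ.* (p ∸ 1) ∸ 1)

-- representative mod p^k of a rational q ∈ ℚ ∩ ℤ_p
resQ : ℕ → ℕ → ℚ → ℤ
resQ p k q = (↥ q) ℤ.* invMod p k (↧ q)

natRep : ℕ → ℕ → ℤ → ℕ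
natRep p k x = ∣ x ℤ.+ (+ (p ℕ.^ k)) ℤ.* (+ ∣ x ∣) ∣

prodCoprime : ℕ → ℕ → ℤ
prodCoprime p zero    = + 1
prodCoprime p (suc j) = (if does (p ∣? j) then + 1 else + j) ℤ.* prodCoprime p j

-- Morita's p-adic gamma function at a natural number m:
-- Γ_p(m) = (-1)^m ∏_{0<j<m, p∤j} j
gammaNat : ℕ → ℕ → ℤ
gammaNat p m = sgn m ℤ.* prodCoprime p m

-- Γ_p(q) modulo p^k for q ∈ ℚ ∩ ℤ_p (p odd): Γ_p is the continuous
-- extension of gammaNat, and Γ_p(x) ≡ Γ_p(y) mod p^k when x ≡ y mod p^k.
gammaP : ℕ → ℕ → ℚ → ℤ
gammaP p k q = gammaNat p (natRep p k (resQ p k q))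

-- Teichmüller character ω(t) modulo p^k, t ∈ {0,…,p-1} representing 𝔽_p:
-- ω(t) = lim t^(p^j), and t^(p^k) ≡ ω(t) mod p^(k+1)
teich : ℕ → ℕ → ℕ → ℤ
teich p k t = (+ t) ℤ.^ (p ℕ.^ k)

-- ω̄^a(t) modulo p^k, with the convention that every character
-- (including the trivial one) vanishes at 0
omegaBarPow : ℕ → ℕ → ℕ → ℕ → ℤ
omegaBarPow p k a t =
  if does (p ∣? t) then + 0 else invMod p k (teich p k t) ℤ.^ a

-- The function  nGn[a_1..a_n ; b_1..b_n | t]  (parameters given as a
-- list of pairs (a_k , b_k), n = length of the list).

xa : ℕ → ℕ → ℚ
xa p a = divℕ a (p ∸ 1)

-- exponent of (-p) in the k-th factor:
--   -⌊⟨a_k⟩ - a/(p-1)⌋ - ⌊⟨-b_k⟩ + a/(p-1)⌋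
expoFactor : ℕ → ℕ → ℚ × ℚ → ℤ
expoFactor p a (ak , bk) =
  ℤ.- floor (fract ak ℚ.- xa p a) ℤ.- floor (fract (ℚ.- bk) ℚ.+ xa p a)

expoTot : ℕ → List (ℚ × ℚ) → ℕ → ℤ
expoTot p ps a = sumℤ (map (expoFactor p a) ps)

gammaFactor : ℕ → ℕ → ℕ → ℚ × ℚ → ℤ
gammaFactor p k a (ak , bk) =
  gammaP p k (fract (ak ℚ.- xa p a)) ℤ.* invMod p k (gammaP p k (fract ak))
  ℤ.* gammaP p k (fract (ℚ.- bk ℚ.+ xa p a))
  ℤ.* invMod p k (gammaP p k (fract (ℚ.- bk)))

range : ℕ → List ℕ
range p = upTo (p ∸ 1)

-- a common shift N with E_a + N ≥ 0 for all a
shift : ℕ → List (ℚ × ℚ) → ℕ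
shift p ps = sumℕ (map (λ a → ∣ expoTot p ps a ∣) (range p))

-- p^N · (a-th summand without the factor -1/(p-1)), modulo p^k, where
-- (-p)^{E_a} p^N = (-1)^{E_a} p^{E_a + N}
summand : ℕ → ℕ → List (ℚ × ℚ) → ℕ → ℕ → ℤ
summand p k ps t a =
  sgn (a ℕ.* Data.List.length ps) ℤ.* omegaBarPow p k a t
  ℤ.* sgnℤ (expoTot p ps a)
  ℤ.* (+ (p ℕ.^ ∣ expoTot p ps a ℤ.+ + shift p ps ∣))
  ℤ.* prodℤ (map (gammaFactor p k a) ps)
  where import Data.List

-- p^N · nGn[…|t]  modulo p^k  (an element of ℤ_p)
scaledG : ℕ → ℕ → List (ℚ × ℚ) → ℕ → ℤ
scaledG p k ps t =
  ℤ.- invMod p k (+ (p ∸ 1)) ℤ.* sumℤ (map (summand p k ps t) (range p))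

-- nGn[… | t] = 0 in ℚ_p  (equivalently p^N · nGn[… | t] = 0 in ℤ_p)
GVanishes : ℕ → List (ℚ × ℚ) → ℕ → Set
GVanishes p ps t = ∀ k → (+ (p ℕ.^ k)) ℤDiv.∣ scaledG p k ps t

-- parameters of nGn:  a_i = (2i-1)/(2n),  b_i = (i-1)/n,  i = 1..n
nGnParams : ℕ → List (ℚ × ℚ)
nGnParams n = map (λ i → divℕ (2 ℕ.* i ℕ.+ 1) (2 ℕ.* n) , divℕ i n) (upTo n)

-- nGn(-1) = 0 over ℚ_p ;  -1 ∈ 𝔽_p is represented by p - 1
nGnMinusOneVanishes : ℕ → ℕ → Set
nGnMinusOneVanishes n p = GVanishes p (nGnParams n) (p ∸ 1)

-- For n = 2m the parameters satisfy a_{i+m} = a_i + 1/2 and b_{i+m} = b_i + 1/2, while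
-- x = a/(p-1) grows by 1/2 when a grows by h = (p-1)/2.  Hence a ↦ a + h only permutes
-- the n factors of a summand, up to integer translations which cancel in the exponent of
-- (-p) and are invisible to the fractional parts; the sign (-1)^{an} is unchanged since n
-- is even, and the character contributes ω̄(t)^h.  So the summands for a and a + h differ
-- exactly by the factor ω̄(t)^h, and the sum over a vanishes as soon as ω̄(t)^h = -1.
-- For t = -1 and p ≡ 3 (mod 4) we have ω̄(-1)^h = (-1)^h = -1, which modulo p^k comes down
-- to (1-p)^{p^k} ≡ 1 (mod p^{k+1}).  Such primes are unbounded by Euclid's argument
-- applied to 4·K! - 1.
module Submission where

open import Defs
open import Data.Nat using (ℕ; _≤_; _<_; _%_)
open import Data.Nat.Divisibility using (_∣_)
open import Data.Nat.Primality using (Prime)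
open import Data.Product using (∃-syntax; _×_)
open import Relation.Nullary using (¬_)
open import Relation.Binary.PropositionalEquality using (_≡_)

open import Algebra.Bundles using (CommutativeMonoid)
open import Data.Bool using (true; false)
open import Data.Integer as ℤ using (ℤ; +_; 0ℤ; 1ℤ; -1ℤ)
open import Data.Integer.DivMod using (_/ℕ_; [n/ℕd]*d≤n; n<s[n/ℕd]*d; div-pos-is-/ℕ)
open import Data.Integer.Divisibility.Signed
  using (divides; ∣-trans; ∣m∣n⇒∣m+n; ∣n⇒∣m*n; ∣m⇒∣m*n; *-monoʳ-∣; *-monoˡ-∣; ∣⇒∣ᵤ)
  renaming (_∣_ to _∣ℤ_)
import Data.Integer.Properties as ℤP
open import Data.Integer.Tactic.RingSolver using (solve-∀)
open import Data.List using (List; []; _∷_; _++_; map; foldr; length; applyUpTo; upTo)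
open import Data.List.Properties using (map-upTo; map-cong; map-∘; length-map; length-upTo)
open import Data.List.Relation.Binary.Permutation.Propositional
  using (_↭_; ↭-refl; ↭⇒↭ₛ′; module PermutationReasoning)
import Data.List.Relation.Binary.Permutation.Propositional.Properties as ↭
import Data.List.Relation.Binary.Permutation.Setoid.Properties as ↭ₛ
open import Data.List.Relation.Unary.All using (All; []; _∷_)
open import Data.Nat using (zero; suc; _+_; _*_; _∸_; _^_; _!; NonZero; >-nonZero; z<s; s≤s)
open import Data.Nat.DivMod using (_/_; %-distribˡ-*; [m+kn]%n≡m%n; m%n<n; m≡m%n+[m/n]*n)
import Data.Nat.Divisibility as ℕ∣
open import Data.Nat.ListAction using (product)
open import Data.Nat.Primality using (¬prime[0]; ¬prime[1])
open import Data.Nat.Primality.Factorisation using (factorise)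
import Data.Nat.Properties as ℕP
import Data.Nat.Tactic.RingSolver as ℕ-Solver
open import Data.Product using (_,_)
open import Data.Rational as ℚ using (ℚ; mkℚ; ↥_; ↧_; floor; ½; 1ℚ; toℚᵘ)
import Data.Rational.Properties as ℚP
open import Data.Rational.Solver using (module +-*-Solver)
open import Data.Rational.Unnormalised as ℚᵘ using (mkℚᵘ; *≡*)
import Data.Rational.Unnormalised.Properties as ℚᵘP
open import Data.Sum using (_⊎_; inj₁; inj₂)
open import Function using (_∘_)
open import Relation.Binary.PropositionalEquality using (refl; sym; trans; cong; cong₂; subst; subst₂; module ≡-Reasoning)
open import Relation.Nullary using (does; yes; no; contradiction)
open import Relation.Nullary.Decidable using (dec-false)

applyUpTo-cong : ∀ {a} {A : Set a} {f g : ℕ → A} → (∀ i → f i ≡ g i) →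
                 ∀ n → applyUpTo f n ≡ applyUpTo g n
applyUpTo-cong {f = f} {g} f≗g n = trans (sym (map-upTo f n)) (trans (map-cong f≗g (upTo n)) (map-upTo g n))

applyUpTo-+ : ∀ {a} {A : Set a} (f : ℕ → A) m n →
              applyUpTo f (m + n) ≡ applyUpTo f m ++ applyUpTo (λ i → f (m + i)) n
applyUpTo-+ f zero    n = refl
applyUpTo-+ f (suc m) n = cong (f 0 ∷_) (applyUpTo-+ (f ∘ suc) m n)

applyUpTo-swapHalves-↭ : ∀ {a} {A : Set a} (f g : ℕ → A) m →
                         (∀ i → g i ≡ f (m + i)) → (∀ i → g (m + i) ≡ f i) →
                         applyUpTo g (m + m) ↭ applyUpTo f (m + m)
applyUpTo-swapHalves-↭ f g m g≗f[m+] g[m+]≗f = begin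
  applyUpTo g (m + m)                             ≡⟨ applyUpTo-+ g m m ⟩
  applyUpTo g m ++ applyUpTo (λ i → g (m + i)) m  ≡⟨ cong₂ _++_ (applyUpTo-cong g≗f[m+] m) (applyUpTo-cong g[m+]≗f m) ⟩
  applyUpTo (λ i → f (m + i)) m ++ applyUpTo f m  ↭⟨ ↭.++-comm (applyUpTo (λ i → f (m + i)) m) (applyUpTo f m) ⟩
  applyUpTo f m ++ applyUpTo (λ i → f (m + i)) m  ≡⟨ applyUpTo-+ f m m ⟨
  applyUpTo f (m + m)                             ∎
  where open PermutationReasoning

module _ {c ℓ} (M : CommutativeMonoid c ℓ) where
  open CommutativeMonoid M hiding (refl; sym; trans)
  private module M = CommutativeMonoid M
  open import Algebra.Properties.CommutativeSemigroup commutativeSemigroup using (interchange)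
  open import Relation.Binary.Reasoning.Setoid setoid

  fold : List Carrier → Carrier
  fold = foldr _∙_ ε

  fold-++ : ∀ xs ys → fold (xs ++ ys) ≈ fold xs ∙ fold ys
  fold-++ []       ys = M.sym (identityˡ (fold ys))
  fold-++ (x ∷ xs) ys = M.trans (∙-congˡ (fold-++ xs ys)) (M.sym (assoc x (fold xs) (fold ys)))

  fold-map-∙ : ∀ {A : Set} (f g : A → Carrier) xs →
               fold (map (λ x → f x ∙ g x) xs) ≈ fold (map f xs) ∙ fold (map g xs)
  fold-map-∙ f g []       = M.sym (identityˡ ε)
  fold-map-∙ f g (x ∷ xs) = begin
    (f x ∙ g x) ∙ fold (map (λ x → f x ∙ g x) xs)      ≈⟨ ∙-congˡ (fold-map-∙ f g xs) ⟩
    (f x ∙ g x) ∙ (fold (map f xs) ∙ fold (map g xs))  ≈⟨ interchange (f x) (g x) _ _ ⟩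
    (f x ∙ fold (map f xs)) ∙ (g x ∙ fold (map g xs))  ∎

  fold-↭ : ∀ {xs ys} → xs ↭ ys → fold xs ≈ fold ys
  fold-↭ xs↭ys = ↭ₛ.foldr-commMonoid setoid isCommutativeMonoid (↭⇒↭ₛ′ isEquivalence xs↭ys)

  fold-map-∙-↭ʳ : ∀ {A : Set} (κ f g : A → Carrier) xs → map g xs ↭ map f xs →
                  fold (map (λ x → κ x ∙ g x) xs) ≈ fold (map (λ x → κ x ∙ f x) xs)
  fold-map-∙-↭ʳ κ f g xs g↭f = begin
    fold (map (λ x → κ x ∙ g x) xs)    ≈⟨ fold-map-∙ κ g xs ⟩
    fold (map κ xs) ∙ fold (map g xs)  ≈⟨ ∙-congˡ (fold-↭ g↭f) ⟩
    fold (map κ xs) ∙ fold (map f xs)  ≈⟨ fold-map-∙ κ f xs ⟨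
    fold (map (λ x → κ x ∙ f x) xs)    ∎

  fold-upTo-halves : ∀ (f : ℕ → Carrier) m →
                     fold (map f (upTo (m + m))) ≈ fold (map (λ i → f i ∙ f (m + i)) (upTo m))
  fold-upTo-halves f m = begin
    fold (map f (upTo (m + m)))
      ≡⟨ cong fold (trans (map-upTo f (m + m)) (applyUpTo-+ f m m)) ⟩
    fold (applyUpTo f m ++ applyUpTo (λ i → f (m + i)) m)
      ≈⟨ fold-++ (applyUpTo f m) (applyUpTo (λ i → f (m + i)) m) ⟩
    fold (applyUpTo f m) ∙ fold (applyUpTo (λ i → f (m + i)) m)
      ≡⟨ cong₂ (λ u v → fold u ∙ fold v) (sym (map-upTo f m)) (sym (map-upTo (λ i → f (m + i)) m)) ⟩
    fold (map f (upTo m)) ∙ fold (map (λ i → f (m + i)) (upTo m))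
      ≈⟨ fold-map-∙ f (λ i → f (m + i)) (upTo m) ⟨
    fold (map (λ i → f i ∙ f (m + i)) (upTo m))
      ∎

-- Floors and fractional parts

/ℕ-unique : ∀ n d .{{_ : NonZero d}} z →
            z ℤ.* + d ℤ.≤ n → n ℤ.< ℤ.suc z ℤ.* + d → n /ℕ d ≡ z
/ℕ-unique n d z lower upper = ℤP.≤-antisym
  (<suc⇒≤ (ℤP.*-cancelʳ-<-nonNeg (+ d) (ℤP.≤-<-trans ([n/ℕd]*d≤n n d) upper)))
  (<suc⇒≤ (ℤP.*-cancelʳ-<-nonNeg (+ d) (ℤP.≤-<-trans lower (n<s[n/ℕd]*d n d))))
  where
  <suc⇒≤ : ∀ {i j} → i ℤ.< ℤ.suc j → i ℤ.≤ j
  <suc⇒≤ {i} {j} i<j+1 = subst (i ℤ.≤_) (ℤP.pred-suc j) (ℤP.i<j⇒i≤pred[j] i<j+1)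

floor-unique : ∀ q z → z ℤ.* ↧ q ℤ.≤ ↥ q → ↥ q ℤ.< ℤ.suc z ℤ.* ↧ q → floor q ≡ z
floor-unique q@(mkℚ n d _) z lower upper =
  trans (div-pos-is-/ℕ n (suc d)) (/ℕ-unique n (suc d) z lower upper)

floor*↧≤↥ : ∀ q → floor q ℤ.* ↧ q ℤ.≤ ↥ q
floor*↧≤↥ q@(mkℚ n d _) =
  subst (λ f → f ℤ.* ↧ q ℤ.≤ n) (sym (div-pos-is-/ℕ n (suc d))) ([n/ℕd]*d≤n n (suc d))

↥<suc[floor]*↧ : ∀ q → ↥ q ℤ.< ℤ.suc (floor q) ℤ.* ↧ q
↥<suc[floor]*↧ q@(mkℚ n d _) =
  subst (λ f → n ℤ.< ℤ.suc f ℤ.* ↧ q) (sym (div-pos-is-/ℕ n (suc d))) (n<s[n/ℕd]*d n (suc d))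

-- ℚ._+_ normalises, so q + z/1 is only accessible through cross-multiplication.
↥[q+z]*↧q : ∀ q z → ↥ (q ℚ.+ z ℚ./ 1) ℤ.* ↧ q ≡ (↥ q ℤ.+ z ℤ.* ↧ q) ℤ.* ↧ (q ℚ.+ z ℚ./ 1)
↥[q+z]*↧q q@(mkℚ n _ _) z = begin
  ↥ r ℤ.* ↧ q                        ≡⟨ cong (↥ r ℤ.*_) (ℤP.*-identityʳ (↧ q)) ⟨
  ↥ r ℤ.* (↧ q ℤ.* 1ℤ)               ≡⟨ cross-multiply (ℚᵘP.≃-trans (ℚP.toℚᵘ-homo-+ q (z ℚ./ 1))
                                          (ℚᵘP.+-congʳ (toℚᵘ q) (ℚP.toℚᵘ-fromℚᵘ (mkℚᵘ z 0)))) ⟩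
  (n ℤ.* 1ℤ ℤ.+ z ℤ.* ↧ q) ℤ.* ↧ r   ≡⟨ cong (λ e → (e ℤ.+ z ℤ.* ↧ q) ℤ.* ↧ r) (ℤP.*-identityʳ n) ⟩
  (n ℤ.+ z ℤ.* ↧ q) ℤ.* ↧ r          ∎
  where
  open ≡-Reasoning
  r = q ℚ.+ z ℚ./ 1
  cross-multiply : ∀ {p u} → toℚᵘ p ℚᵘ.≃ u → ↥ p ℤ.* ℚᵘ.↧ u ≡ ℚᵘ.↥ u ℤ.* ↧ p
  cross-multiply {mkℚ _ _ _} (*≡* eq) = eq

floor-+-ℤ : ∀ q z → floor (q ℚ.+ z ℚ./ 1) ≡ floor q ℤ.+ z
floor-+-ℤ q@(mkℚ n d _) z = floor-unique r (f ℤ.+ z)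
  (ℤP.*-cancelʳ-≤-pos ((f ℤ.+ z) ℤ.* D′) R D (begin
    (f ℤ.+ z) ℤ.* D′ ℤ.* D              ≡⟨ rearrange f z D D′ ⟩
    (f ℤ.* D ℤ.+ z ℤ.* D) ℤ.* D′        ≤⟨ ℤP.*-monoʳ-≤-nonNeg D′ (ℤP.+-monoˡ-≤ (z ℤ.* D) (floor*↧≤↥ q)) ⟩
    (n ℤ.+ z ℤ.* D) ℤ.* D′              ≡⟨ ↥[q+z]*↧q q z ⟨
    R ℤ.* D                             ∎))
  (ℤP.*-cancelʳ-<-nonNeg D (begin-strict
    R ℤ.* D                             ≡⟨ ↥[q+z]*↧q q z ⟩
    (n ℤ.+ z ℤ.* D) ℤ.* D′              <⟨ ℤP.*-monoʳ-<-pos D′ (ℤP.+-monoˡ-< (z ℤ.* D) (↥<suc[floor]*↧ q)) ⟩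
    (ℤ.suc f ℤ.* D ℤ.+ z ℤ.* D) ℤ.* D′  ≡⟨ rearrange′ f z D D′ ⟩
    ℤ.suc (f ℤ.+ z) ℤ.* D′ ℤ.* D        ∎))
  where
  open ℤP.≤-Reasoning
  r = q ℚ.+ z ℚ./ 1
  f = floor q
  R = ↥ r
  D = ↧ q
  D′ = ↧ r
  rearrange : ∀ a b c e → (a ℤ.+ b) ℤ.* e ℤ.* c ≡ (a ℤ.* c ℤ.+ b ℤ.* c) ℤ.* e
  rearrange = solve-∀
  rearrange′ : ∀ a b c e → ((1ℤ ℤ.+ a) ℤ.* c ℤ.+ b ℤ.* c) ℤ.* e ≡ (1ℤ ℤ.+ (a ℤ.+ b)) ℤ.* e ℤ.* c
  rearrange′ = solve-∀

/1-+ : ∀ a b → (a ℤ.+ b) ℚ./ 1 ≡ a ℚ./ 1 ℚ.+ b ℚ./ 1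
/1-+ a b = ℚP.toℚᵘ-injective (begin
  toℚᵘ ((a ℤ.+ b) ℚ./ 1)              ≈⟨ ℚP.toℚᵘ-fromℚᵘ (mkℚᵘ (a ℤ.+ b) 0) ⟩
  mkℚᵘ (a ℤ.+ b) 0                    ≈⟨ *≡* (+-over-1 a b) ⟩
  mkℚᵘ a 0 ℚᵘ.+ mkℚᵘ b 0              ≈⟨ ℚᵘP.+-cong (ℚP.toℚᵘ-fromℚᵘ (mkℚᵘ a 0)) (ℚP.toℚᵘ-fromℚᵘ (mkℚᵘ b 0)) ⟨
  toℚᵘ (a ℚ./ 1) ℚᵘ.+ toℚᵘ (b ℚ./ 1) ≈⟨ ℚP.toℚᵘ-homo-+ (a ℚ./ 1) (b ℚ./ 1) ⟨
  toℚᵘ (a ℚ./ 1 ℚ.+ b ℚ./ 1)          ∎)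
  where
  open ℚᵘP.≃-Reasoning
  +-over-1 : ∀ a b → (a ℤ.+ b) ℤ.* (1ℤ ℤ.* 1ℤ) ≡ (a ℤ.* 1ℤ ℤ.+ b ℤ.* 1ℤ) ℤ.* 1ℤ
  +-over-1 = solve-∀

floor-fract-+ : ∀ q y → floor (fract q ℚ.+ y) ≡ floor (q ℚ.+ y) ℤ.- floor q
floor-fract-+ q y = begin
  floor (fract q ℚ.+ y)                                ≡⟨ add-sub (floor (fract q ℚ.+ y)) (floor q) ⟩
  floor (fract q ℚ.+ y) ℤ.+ floor q ℤ.- floor q        ≡⟨ cong (ℤ._- floor q) (floor-+-ℤ (fract q ℚ.+ y) (floor q)) ⟨
  floor (fract q ℚ.+ y ℚ.+ floor q ℚ./ 1) ℤ.- floor q  ≡⟨ cong (λ s → floor s ℤ.- floor q) (cancel q y (floor q ℚ./ 1)) ⟩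
  floor (q ℚ.+ y) ℤ.- floor q                          ∎
  where
  open ≡-Reasoning
  add-sub : ∀ x f → x ≡ x ℤ.+ f ℤ.- f
  add-sub = solve-∀
  cancel : ∀ q y f → q ℚ.- f ℚ.+ y ℚ.+ f ≡ q ℚ.+ y
  cancel = solve 3 (λ q y f → q :- f :+ y :+ f := q :+ y) refl
    where open +-*-Solver

fract-+-ℤ : ∀ q z → fract (q ℚ.+ z ℚ./ 1) ≡ fract q
fract-+-ℤ q z = begin
  q ℚ.+ z ℚ./ 1 ℚ.- floor (q ℚ.+ z ℚ./ 1) ℚ./ 1   ≡⟨ cong (λ f → q ℚ.+ z ℚ./ 1 ℚ.- f ℚ./ 1) (floor-+-ℤ q z) ⟩
  q ℚ.+ z ℚ./ 1 ℚ.- (floor q ℤ.+ z) ℚ./ 1        ≡⟨ cong (λ f → q ℚ.+ z ℚ./ 1 ℚ.- f) (/1-+ (floor q) z) ⟩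
  q ℚ.+ z ℚ./ 1 ℚ.- (floor q ℚ./ 1 ℚ.+ z ℚ./ 1)  ≡⟨ cancel q (z ℚ./ 1) (floor q ℚ./ 1) ⟩
  q ℚ.- floor q ℚ./ 1                           ∎
  where
  open ≡-Reasoning
  cancel : ∀ q z f → q ℚ.+ z ℚ.- (f ℚ.+ z) ≡ q ℚ.- f
  cancel = solve 3 (λ q z f → q :+ z :- (f :+ z) := q :- f) refl
    where open +-*-Solver

private
  divℕ-+-half-cross : ∀ a c → let D = c * 2 in
                      + (a + c) ℤ.* + (D * 2) ≡ (+ a ℤ.* + 2 ℤ.+ + 1 ℤ.* + D) ℤ.* + D
  divℕ-+-half-cross a c = begin
    + (a + c) ℤ.* + (D * 2)                ≡⟨ ℤP.pos-* (a + c) (D * 2) ⟨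
    + ((a + c) * (D * 2))                  ≡⟨ cong +_ (half a c) ⟩
    + ((a * 2 + 1 * D) * D)                ≡⟨ ℤP.pos-* (a * 2 + 1 * D) D ⟩
    + (a * 2 + 1 * D) ℤ.* + D              ≡⟨ cong (ℤ._* + D) (ℤP.pos-+ (a * 2) (1 * D)) ⟩
    (+ (a * 2) ℤ.+ + (1 * D)) ℤ.* + D      ≡⟨ cong₂ (λ u v → (u ℤ.+ v) ℤ.* + D) (ℤP.pos-* a 2) (ℤP.pos-* 1 D) ⟩
    (+ a ℤ.* + 2 ℤ.+ + 1 ℤ.* + D) ℤ.* + D  ∎
    where
    open ≡-Reasoning
    D = c * 2
    half : ∀ a c → (a + c) * (c * 2 * 2) ≡ (a * 2 + 1 * (c * 2)) * (c * 2)
    half = ℕ-Solver.solve-∀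

divℕ-+-half : ∀ a c .{{_ : NonZero c}} → divℕ (a + c) (c * 2) ≡ divℕ a (c * 2) ℚ.+ ½
divℕ-+-half a c@(suc c-1) = ℚP.toℚᵘ-injective (begin
  toℚᵘ (+ (a + c) ℚ./ D)               ≈⟨ ℚP.toℚᵘ-fromℚᵘ (mkℚᵘ (+ (a + c)) D-1) ⟩
  mkℚᵘ (+ (a + c)) D-1                 ≈⟨ *≡* (divℕ-+-half-cross a c) ⟩
  mkℚᵘ (+ a) D-1 ℚᵘ.+ mkℚᵘ 1ℤ 1        ≈⟨ ℚᵘP.+-congˡ (mkℚᵘ 1ℤ 1) (ℚP.toℚᵘ-fromℚᵘ (mkℚᵘ (+ a) D-1)) ⟨
  toℚᵘ (+ a ℚ./ D) ℚᵘ.+ toℚᵘ ½         ≈⟨ ℚP.toℚᵘ-homo-+ (+ a ℚ./ D) ½ ⟨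
  toℚᵘ (+ a ℚ./ D ℚ.+ ½)               ∎)
  where
  open ℚᵘP.≃-Reasoning
  D = c * 2
  D-1 = suc (c-1 * 2)

sgn-+ : ∀ m n → sgn (m + n) ≡ sgn m ℤ.* sgn n
sgn-+ zero    n = sym (ℤP.*-identityˡ (sgn n))
sgn-+ (suc m) n = trans (cong ℤ.-_ (sgn-+ m n)) (ℤP.neg-distribˡ-* (sgn m) (sgn n))

sgn-even : ∀ n → sgn (n * 2) ≡ 1ℤ
sgn-even zero    = refl
sgn-even (suc n) = trans (ℤP.neg-involutive (sgn (n * 2))) (sgn-even n)

sgn-odd : ∀ n → sgn (suc (n * 2)) ≡ -1ℤ
sgn-odd n = cong ℤ.-_ (sgn-even n)

sgn-*-odd : ∀ m n → sgn m ≡ -1ℤ → sgn (m * n) ≡ sgn n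
sgn-*-odd m zero    _     = cong sgn (ℕP.*-zeroʳ m)
sgn-*-odd m (suc n) odd-m = begin
  sgn (m * suc n)        ≡⟨ cong sgn (ℕP.*-suc m n) ⟩
  sgn (m + m * n)        ≡⟨ sgn-+ m (m * n) ⟩
  sgn m ℤ.* sgn (m * n)  ≡⟨ cong₂ ℤ._*_ odd-m (sgn-*-odd m n odd-m) ⟩
  -1ℤ ℤ.* sgn n          ≡⟨ ℤP.-1*i≡-i (sgn n) ⟩
  sgn (suc n)            ∎
  where open ≡-Reasoning

sgn-^-odd : ∀ m k → sgn m ≡ -1ℤ → sgn (m ^ k) ≡ -1ℤ
sgn-^-odd m zero    _     = refl
sgn-^-odd m (suc k) odd-m = trans (sgn-*-odd m (m ^ k) odd-m) (sgn-^-odd m k odd-m)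

sgn[n*2∸1]≡-1 : ∀ n .{{_ : NonZero n}} → sgn (n * 2 ∸ 1) ≡ -1ℤ
sgn[n*2∸1]≡-1 (suc j) = sgn-odd j

neg-^ : ∀ y n → (ℤ.- y) ℤ.^ n ≡ sgn n ℤ.* y ℤ.^ n
neg-^ y zero    = refl
neg-^ y (suc n) = trans (cong ((ℤ.- y) ℤ.*_) (neg-^ y n)) (step y (sgn n) (y ℤ.^ n))
  where
  step : ∀ y s z → (ℤ.- y) ℤ.* (s ℤ.* z) ≡ (ℤ.- s) ℤ.* (y ℤ.* z)
  step = solve-∀

∣x+1⇒∣x^n-sgn : ∀ {d x} n → d ∣ℤ x ℤ.+ 1ℤ → d ∣ℤ x ℤ.^ n ℤ.- sgn n
∣x+1⇒∣x^n-sgn zero    _      = divides 0ℤ refl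
∣x+1⇒∣x^n-sgn {d} {x} (suc n) d∣x+1 =
  subst (d ∣ℤ_) (sym (step x (x ℤ.^ n) (sgn n)))
        (∣m∣n⇒∣m+n (∣n⇒∣m*n x (∣x+1⇒∣x^n-sgn n d∣x+1)) (∣m⇒∣m*n (sgn n) d∣x+1))
  where
  step : ∀ x z s → x ℤ.* z ℤ.- ℤ.- s ≡ x ℤ.* (z ℤ.- s) ℤ.+ (x ℤ.+ 1ℤ) ℤ.* s
  step = solve-∀

∣-sumℤ : ∀ {d} {A : Set} (f : A → ℤ) xs → (∀ x → d ∣ℤ f x) → d ∣ℤ sumℤ (map f xs)
∣-sumℤ f []       _    = divides 0ℤ refl
∣-sumℤ f (x ∷ xs) d∣f = ∣m∣n⇒∣m+n (d∣f x) (∣-sumℤ f xs d∣f)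

geometricSum : ℤ → ℕ → ℤ
geometricSum y zero    = 0ℤ
geometricSum y (suc n) = 1ℤ ℤ.+ y ℤ.* geometricSum y n

y^n-1≡[y-1]*geometricSum : ∀ y n → y ℤ.^ n ℤ.- 1ℤ ≡ (y ℤ.- 1ℤ) ℤ.* geometricSum y n
y^n-1≡[y-1]*geometricSum y zero    = sym (ℤP.*-zeroʳ (y ℤ.- 1ℤ))
y^n-1≡[y-1]*geometricSum y (suc n) = begin
  y ℤ.* y ℤ.^ n ℤ.- 1ℤ                      ≡⟨ split y (y ℤ.^ n) ⟩
  y ℤ.* (y ℤ.^ n ℤ.- 1ℤ) ℤ.+ (y ℤ.- 1ℤ)     ≡⟨ cong (λ e → y ℤ.* e ℤ.+ (y ℤ.- 1ℤ)) (y^n-1≡[y-1]*geometricSum y n) ⟩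
  y ℤ.* ((y ℤ.- 1ℤ) ℤ.* G) ℤ.+ (y ℤ.- 1ℤ)   ≡⟨ collect y G ⟩
  (y ℤ.- 1ℤ) ℤ.* (1ℤ ℤ.+ y ℤ.* G)           ∎
  where
  open ≡-Reasoning
  G = geometricSum y n
  split : ∀ y z → y ℤ.* z ℤ.- 1ℤ ≡ y ℤ.* (z ℤ.- 1ℤ) ℤ.+ (y ℤ.- 1ℤ)
  split = solve-∀
  collect : ∀ y g → y ℤ.* ((y ℤ.- 1ℤ) ℤ.* g) ℤ.+ (y ℤ.- 1ℤ) ≡ (y ℤ.- 1ℤ) ℤ.* (1ℤ ℤ.+ y ℤ.* g)
  collect = solve-∀

∣y-1⇒∣geometricSum-n : ∀ {d y} n → d ∣ℤ y ℤ.- 1ℤ → d ∣ℤ geometricSum y n ℤ.- + n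
∣y-1⇒∣geometricSum-n zero    _      = divides 0ℤ refl
∣y-1⇒∣geometricSum-n {d} {y} (suc n) d∣y-1 =
  subst (d ∣ℤ_) (sym (trans (cong (λ e → 1ℤ ℤ.+ y ℤ.* G ℤ.- e) (ℤP.pos-+ 1 n)) (split y G (+ n))))
        (∣m∣n⇒∣m+n (∣n⇒∣m*n y (∣y-1⇒∣geometricSum-n n d∣y-1)) (∣n⇒∣m*n (+ n) d∣y-1))
  where
  G = geometricSum y n
  split : ∀ y g n → 1ℤ ℤ.+ y ℤ.* g ℤ.- (1ℤ ℤ.+ n) ≡ y ℤ.* (g ℤ.- n) ℤ.+ n ℤ.* (y ℤ.- 1ℤ)
  split = solve-∀

-- y^p - 1 = (y - 1)(1 + y + … + y^(p-1)), and the second factor is ≡ p (mod M).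
∣y-1⇒*p∣y^p-1 : ∀ {M y} p → M ∣ℤ y ℤ.- 1ℤ → + p ∣ℤ M → M ℤ.* + p ∣ℤ y ℤ.^ p ℤ.- 1ℤ
∣y-1⇒*p∣y^p-1 {M} {y} p M∣y-1 p∣M =
  subst (M ℤ.* + p ∣ℤ_) (sym (y^n-1≡[y-1]*geometricSum y p))
        (∣-trans (*-monoˡ-∣ (+ p) M∣y-1) (*-monoʳ-∣ (y ℤ.- 1ℤ) p∣G))
  where
  G = geometricSum y p
  p∣G : + p ∣ℤ G
  p∣G = subst (+ p ∣ℤ_) (sub-add G (+ p))
              (∣m∣n⇒∣m+n (∣-trans p∣M (∣y-1⇒∣geometricSum-n p M∣y-1))
                         (divides 1ℤ (sym (ℤP.*-identityˡ (+ p)))))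
    where
    sub-add : ∀ g q → g ℤ.- q ℤ.+ q ≡ g
    sub-add = solve-∀

p^[1+k]∣[1-p]^p^k-1 : ∀ p k → + (p ^ suc k) ∣ℤ (1ℤ ℤ.- + p) ℤ.^ (p ^ k) ℤ.- 1ℤ
p^[1+k]∣[1-p]^p^k-1 p zero    =
  divides -1ℤ (trans (base (+ p)) (cong (λ e → -1ℤ ℤ.* + e) (sym (ℕP.*-identityʳ p))))
  where
  base : ∀ P → (1ℤ ℤ.- P) ℤ.* 1ℤ ℤ.- 1ℤ ≡ -1ℤ ℤ.* P
  base = solve-∀
p^[1+k]∣[1-p]^p^k-1 p (suc k) =
  subst₂ _∣ℤ_ (trans (sym (ℤP.pos-* (p ^ suc k) p)) (cong +_ (ℕP.*-comm (p ^ suc k) p)))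
             (cong (ℤ._- 1ℤ) (trans (ℤP.^-*-assoc y (p ^ k) p) (cong (y ℤ.^_) (ℕP.*-comm (p ^ k) p))))
             (∣y-1⇒*p∣y^p-1 p (p^[1+k]∣[1-p]^p^k-1 p k) p∣p^[1+k])
  where
  y = 1ℤ ℤ.- + p
  p∣p^[1+k] : + p ∣ℤ + (p ^ suc k)
  p∣p^[1+k] = divides (+ (p ^ k)) (trans (ℤP.pos-* p (p ^ k)) (ℤP.*-comm (+ p) (+ (p ^ k))))

-- Primes congruent to 3 modulo 4

residue≡3 : ∀ r s → r < 4 → s < 4 → (r * s) % 4 ≡ 3 → r ≡ 3 ⊎ s ≡ 3
residue≡3 3 _ _ _ _ = inj₁ refl
residue≡3 _ 3 _ _ _ = inj₂ refl
residue≡3 0 _ _ _ ()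
residue≡3 1 0 _ _ ()
residue≡3 1 1 _ _ ()
residue≡3 1 2 _ _ ()
residue≡3 2 0 _ _ ()
residue≡3 2 1 _ _ ()
residue≡3 2 2 _ _ ()
residue≡3 (suc (suc (suc (suc _)))) _ (s≤s (s≤s (s≤s (s≤s ())))) _ _
residue≡3 _ (suc (suc (suc (suc _)))) _ (s≤s (s≤s (s≤s (s≤s ())))) _

*≡3[mod4] : ∀ a b → (a * b) % 4 ≡ 3 → a % 4 ≡ 3 ⊎ b % 4 ≡ 3
*≡3[mod4] a b ab≡3 =
  residue≡3 (a % 4) (b % 4) (m%n<n a 4) (m%n<n b 4) (trans (sym (%-distribˡ-* a b 4)) ab≡3)

product≡3[mod4] : ∀ ns → All Prime ns → product ns % 4 ≡ 3 → ∃[ q ] Prime q × q ∣ product ns × q % 4 ≡ 3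
product≡3[mod4] []       []         ()
product≡3[mod4] (n ∷ ns) (pn ∷ pns) prod≡3 with *≡3[mod4] n (product ns) prod≡3
... | inj₁ n≡3    = n , pn , ℕ∣.m∣m*n (product ns) , n≡3
... | inj₂ rest≡3 with product≡3[mod4] ns pns rest≡3
...   | q , pq , q∣rest , q≡3 = q , pq , ℕ∣.∣n⇒∣m*n n q∣rest , q≡3

prime-factor≡3[mod4] : ∀ N → N % 4 ≡ 3 → ∃[ q ] Prime q × q ∣ N × q % 4 ≡ 3
prime-factor≡3[mod4] zero    ()
prime-factor≡3[mod4] N@(suc _) N≡3 with factorise N
... | record { factors = ns ; isFactorisation = N≡∏ ; factorsPrime = pns } =
  subst (λ M → ∃[ q ] Prime q × q ∣ M × q % 4 ≡ 3) (sym N≡∏)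
        (product≡3[mod4] ns pns (subst (λ M → M % 4 ≡ 3) N≡∏ N≡3))

-- Euclid: 4n - 1 = 3 + 4(n - 1) has a prime factor ≡ 3 (mod 4), and it cannot divide n.
prime≡3[mod4]-∤ : ∀ n .{{_ : NonZero n}} → ∃[ q ] Prime q × q % 4 ≡ 3 × ¬ (q ∣ n)
prime≡3[mod4]-∤ n@(suc f) with prime-factor≡3[mod4] (3 + f * 4) ([m+kn]%n≡m%n 3 f 4)
... | q , pq , q∣N , q≡3 = q , pq , q≡3 , λ q∣n → ¬prime[1] (subst Prime (ℕ∣.∣1⇒≡1 (q∣1 q∣n)) pq)
  where
  N = 3 + f * 4
  q∣1 : q ∣ n → q ∣ 1
  q∣1 q∣n = ℕ∣.∣m+n∣m⇒∣n (subst (q ∣_) (ℕP.+-comm 1 N) (ℕ∣.∣m⇒∣m*n 4 q∣n)) q∣N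

prime≡3[mod4]-above : ∀ K → ∃[ q ] K < q × Prime q × q % 4 ≡ 3
prime≡3[mod4]-above K with prime≡3[mod4]-∤ (K !) {{K ℕP.!≢0}}
... | q , pq , q≡3 , q∤K! with q ℕP.≤? K
...   | no  q≰K = q , ℕP.≰⇒> q≰K , pq , q≡3
...   | yes q≤K = contradiction (ℕ∣.∣-trans (q∣q! q pq) (ℕ∣.m≤n⇒m!∣n! q≤K)) q∤K!
  where
  q∣q! : ∀ q → Prime q → q ∣ q !
  q∣q! zero      p0 = contradiction p0 ¬prime[0]
  q∣q! (suc q-1) _  = ℕ∣.m∣m*n (q-1 !)

-- Powers of the Teichmüller character at -1

-- p - 1 = -(1 - p) and p^k is odd.
teich[-1]≡-1 : ∀ h k → let p = suc (h * 2) in + (p ^ suc k) ∣ℤ teich p k (p ∸ 1) ℤ.+ 1ℤ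
teich[-1]≡-1 h k = subst (+ (p ^ suc k) ∣ℤ_) (sym teich+1) (∣m⇒∣m*n -1ℤ (p^[1+k]∣[1-p]^p^k-1 p k))
  where
  open ≡-Reasoning
  p = suc (h * 2)
  y = 1ℤ ℤ.- + p
  Y = y ℤ.^ (p ^ k)
  p-1≡-y : + (h * 2) ≡ ℤ.- y
  p-1≡-y = trans (negate (+ (h * 2))) (cong (λ e → ℤ.- (1ℤ ℤ.- e)) (sym (ℤP.pos-+ 1 (h * 2))))
    where
    negate : ∀ x → x ≡ ℤ.- (1ℤ ℤ.- (1ℤ ℤ.+ x))
    negate = solve-∀
  teich+1 : teich p k (p ∸ 1) ℤ.+ 1ℤ ≡ (Y ℤ.- 1ℤ) ℤ.* -1ℤ
  teich+1 = begin
    (+ (h * 2)) ℤ.^ (p ^ k) ℤ.+ 1ℤ  ≡⟨ cong (λ e → e ℤ.^ (p ^ k) ℤ.+ 1ℤ) p-1≡-y ⟩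
    (ℤ.- y) ℤ.^ (p ^ k) ℤ.+ 1ℤ      ≡⟨ cong (ℤ._+ 1ℤ) (neg-^ y (p ^ k)) ⟩
    sgn (p ^ k) ℤ.* Y ℤ.+ 1ℤ        ≡⟨ cong (λ s → s ℤ.* Y ℤ.+ 1ℤ) (sgn-^-odd p k (sgn-odd h)) ⟩
    -1ℤ ℤ.* Y ℤ.+ 1ℤ                ≡⟨ flip Y ⟩
    (Y ℤ.- 1ℤ) ℤ.* -1ℤ              ∎
    where
    flip : ∀ Y → -1ℤ ℤ.* Y ℤ.+ 1ℤ ≡ (Y ℤ.- 1ℤ) ℤ.* -1ℤ
    flip = solve-∀

omegaBarPow-+ : ∀ p k a b t → omegaBarPow p k (a + b) t ≡ omegaBarPow p k a t ℤ.* omegaBarPow p k b t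
omegaBarPow-+ p k a b t with does (p ℕ∣.∣? t)
... | true  = refl
... | false = ℤP.^-distribˡ-+-* (invMod p k (teich p k t)) a b

omegaBarPow-unit : ∀ p k a t → ¬ (p ∣ t) → omegaBarPow p k a t ≡ invMod p k (teich p k t) ℤ.^ a
omegaBarPow-unit p k a t p∤t rewrite dec-false (p ℕ∣.∣? t) p∤t = refl

-- invMod raises to the odd power E = p^k (p-1) - 1, so ω̄(-1)^h ≡ (-1)^(E h) = -1 for odd h.
omegaBar[-1]^half≡-1 : ∀ j k → let h = suc (j * 2); p = suc (h * 2) in
                       + (p ^ k) ∣ℤ omegaBarPow p k h (p ∸ 1) ℤ.+ 1ℤ
omegaBar[-1]^half≡-1 j k = subst (λ w → + (p ^ k) ∣ℤ w ℤ.+ 1ℤ) (sym ω̄^h≡T^[E*h])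
  (subst (λ s → + (p ^ k) ∣ℤ T ℤ.^ (E * h) ℤ.- s) sgn[E*h]≡-1
    (∣x+1⇒∣x^n-sgn (E * h) (∣-trans p^k∣p^[1+k] (teich[-1]≡-1 h k))))
  where
  h = suc (j * 2)
  p = suc (h * 2)
  T = teich p k (p ∸ 1)
  E = p ^ k * (p ∸ 1) ∸ 1
  p∤p-1 : ¬ (p ∣ p ∸ 1)
  p∤p-1 p∣p-1 = ℕP.<-irrefl refl (ℕ∣.∣⇒≤ p∣p-1)
  ω̄^h≡T^[E*h] : omegaBarPow p k h (p ∸ 1) ≡ T ℤ.^ (E * h)
  ω̄^h≡T^[E*h] = trans (omegaBarPow-unit p k h (p ∸ 1) p∤p-1) (ℤP.^-*-assoc T E h)
  sgn[E]≡-1 : sgn E ≡ -1ℤ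
  sgn[E]≡-1 = trans (cong (λ e → sgn (e ∸ 1)) (sym (ℕP.*-assoc (p ^ k) h 2)))
                    (sgn[n*2∸1]≡-1 (p ^ k * h) {{ℕP.m*n≢0 (p ^ k) h {{ℕP.m^n≢0 p k}}}})
  sgn[E*h]≡-1 : sgn (E * h) ≡ -1ℤ
  sgn[E*h]≡-1 = trans (sgn-*-odd E h sgn[E]≡-1) (sgn-odd j)
  p^k∣p^[1+k] : + (p ^ k) ∣ℤ + (p ^ suc k)
  p^k∣p^[1+k] = divides (+ p) (ℤP.pos-* p (p ^ k))

-- The half-period symmetry of nGn for even n

shiftPair : ℚ × ℚ → ℚ × ℚ
shiftPair (q , r) = q ℚ.+ ½ , r ℚ.+ ½

-- The k-th factor of the a-th summand depends on (a_k , b_k) through a_k - x and -b_k + x,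
-- where x = a/(p-1).
factorAt : ∀ {a} {A : Set a} → (ℚ → ℚ → A) → ℚ → ℚ × ℚ → A
factorAt φ x (q , r) = φ (q ℚ.- x) (ℚ.- r ℚ.+ x)

module _ {a} {A : Set a} (φ : ℚ → ℚ → A) where

  factorAt-+½ : (∀ s t → φ (s ℚ.- 1ℚ) (t ℚ.+ 1ℚ) ≡ φ s t) →
                ∀ x π → factorAt φ (x ℚ.+ ½) π ≡ factorAt φ x (shiftPair π)
  factorAt-+½ φ-shift x (q , r) = trans (cong₂ φ (lower q x) (upper r x)) (φ-shift _ _)
    where
    open +-*-Solver
    lower : ∀ q x → q ℚ.- (x ℚ.+ ½) ≡ q ℚ.+ ½ ℚ.- x ℚ.- 1ℚ
    lower = solve 2 (λ q x → q :- (x :+ con ½) := q :+ con ½ :- x :- con 1ℚ) refl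
    upper : ∀ r x → ℚ.- r ℚ.+ (x ℚ.+ ½) ≡ ℚ.- (r ℚ.+ ½) ℚ.+ x ℚ.+ 1ℚ
    upper = solve 2 (λ r x → :- r :+ (x :+ con ½) := :- (r :+ con ½) :+ x :+ con 1ℚ) refl

  factorAt-+½-shiftPair : ∀ x π → factorAt φ (x ℚ.+ ½) (shiftPair π) ≡ factorAt φ x π
  factorAt-+½-shiftPair x (q , r) = cong₂ φ (lower q x) (upper r x)
    where
    open +-*-Solver
    lower : ∀ q x → q ℚ.+ ½ ℚ.- (x ℚ.+ ½) ≡ q ℚ.- x
    lower = solve 2 (λ q x → q :+ con ½ :- (x :+ con ½) := q :- x) refl
    upper : ∀ r x → ℚ.- (r ℚ.+ ½) ℚ.+ (x ℚ.+ ½) ≡ ℚ.- r ℚ.+ x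
    upper = solve 2 (λ r x → :- (r :+ con ½) :+ (x :+ con ½) := :- r :+ x) refl

-- For n = 2m, (a_{m+i} , b_{m+i}) = (a_i + 1/2 , b_i + 1/2).
nGnParams-swap-↭ : ∀ m {a} {A : Set a} {f g : ℚ × ℚ → A} →
                   (∀ π → g π ≡ f (shiftPair π)) → (∀ π → g (shiftPair π) ≡ f π) →
                   map g (nGnParams (m * 2)) ↭ map f (nGnParams (m * 2))
nGnParams-swap-↭ zero    _ _ = ↭-refl
nGnParams-swap-↭ m@(suc _) {f = f} {g} g≗f∘shift g∘shift≗f = begin
  map g (nGnParams n)           ≡⟨ map-nGnParams g ⟩
  applyUpTo (g ∘ pair) (m + m)  ↭⟨ applyUpTo-swapHalves-↭ (f ∘ pair) (g ∘ pair) m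
                                     (λ i → trans (g≗f∘shift (pair i)) (cong f (sym (pair-shift i))))
                                     (λ i → trans (cong g (pair-shift i)) (g∘shift≗f (pair i))) ⟩
  applyUpTo (f ∘ pair) (m + m)  ≡⟨ map-nGnParams f ⟨
  map f (nGnParams n)           ∎
  where
  open PermutationReasoning
  n = m * 2
  pair : ℕ → ℚ × ℚ
  pair i = divℕ (2 * i + 1) (2 * n) , divℕ i n
  map-nGnParams : ∀ {b} {B : Set b} (h : ℚ × ℚ → B) → map h (nGnParams n) ≡ applyUpTo (h ∘ pair) (m + m)
  map-nGnParams h =
    trans (sym (map-∘ (upTo n))) (trans (map-upTo (h ∘ pair) n) (cong (applyUpTo (h ∘ pair)) (m*2≡m+m m)))
    where
    m*2≡m+m : ∀ m → m * 2 ≡ m + m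
    m*2≡m+m = ℕ-Solver.solve-∀
  pair-shift : ∀ i → pair (m + i) ≡ shiftPair (pair i)
  pair-shift i = cong₂ _,_
    (trans (cong₂ divℕ (numerator m i) (denominator m)) (trans (divℕ-+-half (2 * i + 1) n)
           (cong (λ d → divℕ (2 * i + 1) d ℚ.+ ½) (sym (denominator m)))))
    (trans (cong (λ a → divℕ a n) (ℕP.+-comm m i)) (divℕ-+-half i m))
    where
    numerator : ∀ m i → 2 * (m + i) + 1 ≡ 2 * i + 1 + m * 2
    numerator = ℕ-Solver.solve-∀
    denominator : ∀ m → 2 * (m * 2) ≡ m * 2 * 2
    denominator = ℕ-Solver.solve-∀

module _ {c ℓ} (M : CommutativeMonoid c ℓ) where
  open CommutativeMonoid M using (Carrier; _≈_; _∙_)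

  fold-factorAt-+½ : (φ : ℚ → ℚ → Carrier) → (∀ s t → φ (s ℚ.- 1ℚ) (t ℚ.+ 1ℚ) ≡ φ s t) →
                     (κ : ℚ × ℚ → Carrier) → ∀ m x →
                     fold M (map (λ π → κ π ∙ factorAt φ (x ℚ.+ ½) π) (nGnParams (m * 2))) ≈
                     fold M (map (λ π → κ π ∙ factorAt φ x π) (nGnParams (m * 2)))
  fold-factorAt-+½ φ φ-shift κ m x =
    fold-map-∙-↭ʳ M κ (factorAt φ x) (factorAt φ (x ℚ.+ ½)) (nGnParams (m * 2))
      (nGnParams-swap-↭ m (factorAt-+½ φ φ-shift x) (factorAt-+½-shiftPair φ x))

negFloorSum : ℚ → ℚ → ℤ
negFloorSum s t = ℤ.- (floor s ℤ.+ floor t)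

negFloorSum-shift : ∀ s t → negFloorSum (s ℚ.- 1ℚ) (t ℚ.+ 1ℚ) ≡ negFloorSum s t
negFloorSum-shift s t =
  trans (cong₂ (λ u v → ℤ.- (u ℤ.+ v)) (floor-+-ℤ s -1ℤ) (floor-+-ℤ t 1ℤ)) (cancel (floor s) (floor t))
  where
  cancel : ∀ u v → ℤ.- ((u ℤ.+ -1ℤ) ℤ.+ (v ℤ.+ 1ℤ)) ≡ ℤ.- (u ℤ.+ v)
  cancel = solve-∀

expoFactor-split : ∀ p a q r →
  expoFactor p a (q , r) ≡ (floor q ℤ.+ floor (ℚ.- r)) ℤ.+ factorAt negFloorSum (xa p a) (q , r)
expoFactor-split p a q r =
  trans (cong₂ (λ u v → ℤ.- u ℤ.- v) (floor-fract-+ q (ℚ.- x)) (floor-fract-+ (ℚ.- r) x))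
        (regroup (floor (q ℚ.- x)) (floor (ℚ.- r ℚ.+ x)) (floor q) (floor (ℚ.- r)))
  where
  x = xa p a
  regroup : ∀ a b c d → ℤ.- (a ℤ.- c) ℤ.- (b ℤ.- d) ≡ (c ℤ.+ d) ℤ.+ ℤ.- (a ℤ.+ b)
  regroup = solve-∀

expoTot-+½ : ∀ m p a a′ → xa p a′ ≡ xa p a ℚ.+ ½ →
             expoTot p (nGnParams (m * 2)) a′ ≡ expoTot p (nGnParams (m * 2)) a
expoTot-+½ m p a a′ x′≡x+½ = begin
  sumℤ (map (expoFactor p a′) ps)
    ≡⟨ cong sumℤ (map-cong split′ ps) ⟩
  sumℤ (map (λ π → κ π ℤ.+ factorAt negFloorSum (xa p a ℚ.+ ½) π) ps)
    ≡⟨ fold-factorAt-+½ ℤP.+-0-commutativeMonoid negFloorSum negFloorSum-shift κ m (xa p a) ⟩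
  sumℤ (map (λ π → κ π ℤ.+ factorAt negFloorSum (xa p a) π) ps)
    ≡⟨ cong sumℤ (map-cong split ps) ⟨
  sumℤ (map (expoFactor p a) ps)
    ∎
  where
  open ≡-Reasoning
  ps = nGnParams (m * 2)
  κ : ℚ × ℚ → ℤ
  κ (q , r) = floor q ℤ.+ floor (ℚ.- r)
  split : ∀ π → expoFactor p a π ≡ κ π ℤ.+ factorAt negFloorSum (xa p a) π
  split (q , r) = expoFactor-split p a q r
  split′ : ∀ π → expoFactor p a′ π ≡ κ π ℤ.+ factorAt negFloorSum (xa p a ℚ.+ ½) π
  split′ (q , r) = trans (expoFactor-split p a′ q r)
                         (cong (λ x → κ (q , r) ℤ.+ factorAt negFloorSum x (q , r)) x′≡x+½)

gammaPair : ℕ → ℕ → ℚ → ℚ → ℤ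
gammaPair p k s t = gammaP p k (fract s) ℤ.* gammaP p k (fract t)

gammaPair-shift : ∀ p k s t → gammaPair p k (s ℚ.- 1ℚ) (t ℚ.+ 1ℚ) ≡ gammaPair p k s t
gammaPair-shift p k s t = cong₂ (λ u v → gammaP p k u ℤ.* gammaP p k v) (fract-+-ℤ s -1ℤ) (fract-+-ℤ t 1ℤ)

gammaFactor-split : ∀ p k a q r → gammaFactor p k a (q , r) ≡
  (invMod p k (gammaP p k (fract q)) ℤ.* invMod p k (gammaP p k (fract (ℚ.- r))))
    ℤ.* factorAt (gammaPair p k) (xa p a) (q , r)
gammaFactor-split p k a q r =
  regroup (gammaP p k (fract (q ℚ.- x))) (invMod p k (gammaP p k (fract q)))
          (gammaP p k (fract (ℚ.- r ℚ.+ x))) (invMod p k (gammaP p k (fract (ℚ.- r))))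
  where
  x = xa p a
  regroup : ∀ a b c d → a ℤ.* b ℤ.* c ℤ.* d ≡ (b ℤ.* d) ℤ.* (a ℤ.* c)
  regroup = solve-∀

gammaProduct-+½ : ∀ m p k a a′ → xa p a′ ≡ xa p a ℚ.+ ½ →
                  prodℤ (map (gammaFactor p k a′) (nGnParams (m * 2))) ≡
                  prodℤ (map (gammaFactor p k a) (nGnParams (m * 2)))
gammaProduct-+½ m p k a a′ x′≡x+½ = begin
  prodℤ (map (gammaFactor p k a′) ps)
    ≡⟨ cong prodℤ (map-cong split′ ps) ⟩
  prodℤ (map (λ π → κ π ℤ.* factorAt (gammaPair p k) (xa p a ℚ.+ ½) π) ps)
    ≡⟨ fold-factorAt-+½ ℤP.*-1-commutativeMonoid (gammaPair p k) (gammaPair-shift p k) κ m (xa p a) ⟩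
  prodℤ (map (λ π → κ π ℤ.* factorAt (gammaPair p k) (xa p a) π) ps)
    ≡⟨ cong prodℤ (map-cong split ps) ⟨
  prodℤ (map (gammaFactor p k a) ps)
    ∎
  where
  open ≡-Reasoning
  ps = nGnParams (m * 2)
  κ : ℚ × ℚ → ℤ
  κ (q , r) = invMod p k (gammaP p k (fract q)) ℤ.* invMod p k (gammaP p k (fract (ℚ.- r)))
  split : ∀ π → gammaFactor p k a π ≡ κ π ℤ.* factorAt (gammaPair p k) (xa p a) π
  split (q , r) = gammaFactor-split p k a q r
  split′ : ∀ π → gammaFactor p k a′ π ≡ κ π ℤ.* factorAt (gammaPair p k) (xa p a ℚ.+ ½) π
  split′ (q , r) = trans (gammaFactor-split p k a′ q r)
                         (cong (λ x → κ (q , r) ℤ.* factorAt (gammaPair p k) x (q , r)) x′≡x+½)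

length-nGnParams : ∀ n → length (nGnParams n) ≡ n
length-nGnParams n = trans (length-map _ (upTo n)) (length-upTo n)

summand-+½ : ∀ m p k t a h → xa p (a + h) ≡ xa p a ℚ.+ ½ →
             summand p k (nGnParams (m * 2)) t (a + h) ≡
             summand p k (nGnParams (m * 2)) t a ℤ.* omegaBarPow p k h t
summand-+½ m p k t a h x′≡x+½ = begin
  assemble (sgn ((a + h) * length ps)) (ω̄ (a + h)) (expoTot p ps (a + h)) (Γ (a + h))
    ≡⟨ cong₂ (λ σ w → assemble σ w (expoTot p ps (a + h)) (Γ (a + h))) sgn-eq (omegaBarPow-+ p k a h t) ⟩
  assemble (sgn (a * length ps)) (ω̄ a ℤ.* ω̄ h) (expoTot p ps (a + h)) (Γ (a + h))
    ≡⟨ cong₂ (assemble (sgn (a * length ps)) (ω̄ a ℤ.* ω̄ h))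
             (expoTot-+½ m p a (a + h) x′≡x+½) (gammaProduct-+½ m p k a (a + h) x′≡x+½) ⟩
  assemble (sgn (a * length ps)) (ω̄ a ℤ.* ω̄ h) (expoTot p ps a) (Γ a)
    ≡⟨ regroup (sgn (a * length ps)) (ω̄ a) (ω̄ h) (sgnℤ (expoTot p ps a)) _ (Γ a) ⟩
  assemble (sgn (a * length ps)) (ω̄ a) (expoTot p ps a) (Γ a) ℤ.* ω̄ h ∎
  where
  open ≡-Reasoning
  ps = nGnParams (m * 2)
  ω̄ : ℕ → ℤ
  ω̄ b = omegaBarPow p k b t
  Γ : ℕ → ℤ
  Γ b = prodℤ (map (gammaFactor p k b) ps)
  assemble : ℤ → ℤ → ℤ → ℤ → ℤ
  assemble σ w e g = σ ℤ.* w ℤ.* sgnℤ e ℤ.* + (p ^ ℤ.∣ e ℤ.+ + shift p ps ∣) ℤ.* g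
  sgn-eq : sgn ((a + h) * length ps) ≡ sgn (a * length ps)
  sgn-eq rewrite length-nGnParams (m * 2) = begin
    sgn ((a + h) * (m * 2))                ≡⟨ cong sgn (expand a h m) ⟩
    sgn (h * m * 2 + a * (m * 2))          ≡⟨ sgn-+ (h * m * 2) (a * (m * 2)) ⟩
    sgn (h * m * 2) ℤ.* sgn (a * (m * 2))  ≡⟨ cong (ℤ._* sgn (a * (m * 2))) (sgn-even (h * m)) ⟩
    1ℤ ℤ.* sgn (a * (m * 2))               ≡⟨ ℤP.*-identityˡ _ ⟩
    sgn (a * (m * 2))                      ∎
    where
    expand : ∀ a h m → (a + h) * (m * 2) ≡ h * m * 2 + a * (m * 2)
    expand = ℕ-Solver.solve-∀
  regroup : ∀ σ w v s P g → σ ℤ.* (w ℤ.* v) ℤ.* s ℤ.* P ℤ.* g ≡ σ ℤ.* w ℤ.* s ℤ.* P ℤ.* g ℤ.* v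
  regroup = solve-∀

xa-+-half : ∀ h a .{{_ : NonZero h}} → xa (suc (h * 2)) (a + h) ≡ xa (suc (h * 2)) a ℚ.+ ½
xa-+-half h a = divℕ-+-half a h

GVanishes-if-ω̄^half≡-1 : ∀ m h t .{{_ : NonZero h}} → let p = suc (h * 2) in
                         (∀ k → + (p ^ k) ∣ℤ omegaBarPow p k h t ℤ.+ 1ℤ) →
                         GVanishes p (nGnParams (m * 2)) t
GVanishes-if-ω̄^half≡-1 m h t ω̄^h≡-1 k = ∣⇒∣ᵤ (∣n⇒∣m*n (ℤ.- invMod p k (+ (p ∸ 1))) p^k∣Σ)
  where
  p = suc (h * 2)
  s = summand p k (nGnParams (m * 2)) t
  pair∣ : ∀ a → + (p ^ k) ∣ℤ s a ℤ.+ s (h + a)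
  pair∣ a = subst (+ (p ^ k) ∣ℤ_) (sym pair≡) (∣n⇒∣m*n (s a) (ω̄^h≡-1 k))
    where
    pair≡ : s a ℤ.+ s (h + a) ≡ s a ℤ.* (omegaBarPow p k h t ℤ.+ 1ℤ)
    pair≡ = trans (cong (λ b → s a ℤ.+ s b) (ℕP.+-comm h a))
                  (trans (cong (λ e → s a ℤ.+ e) (summand-+½ m p k t a h (xa-+-half h a))) (factor (s a) _))
      where
      factor : ∀ x w → x ℤ.+ x ℤ.* w ≡ x ℤ.* (w ℤ.+ 1ℤ)
      factor = solve-∀
  sum-in-pairs : sumℤ (map s (range p)) ≡ sumℤ (map (λ a → s a ℤ.+ s (h + a)) (upTo h))
  sum-in-pairs = trans (cong (λ n → sumℤ (map s (upTo n))) (h*2≡h+h h))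
                       (fold-upTo-halves ℤP.+-0-commutativeMonoid s h)
    where
    h*2≡h+h : ∀ h → h * 2 ≡ h + h
    h*2≡h+h = ℕ-Solver.solve-∀
  p^k∣Σ : + (p ^ k) ∣ℤ sumℤ (map s (range p))
  p^k∣Σ = subst (+ (p ^ k) ∣ℤ_) (sym sum-in-pairs) (∣-sumℤ _ (upTo h) pair∣)

p≡1+2[1+2[p/4]] : ∀ p → p % 4 ≡ 3 → p ≡ suc (suc (p / 4 * 2) * 2)
p≡1+2[1+2[p/4]] p p≡3 = trans (m≡m%n+[m/n]*n p 4) (trans (cong (_+ p / 4 * 4) p≡3) (regroup (p / 4)))
  where
  regroup : ∀ t → 3 + t * 4 ≡ suc (suc (t * 2) * 2)
  regroup = ℕ-Solver.solve-∀

corollary2p6 : (n : ℕ) → 4 ≤ n → 2 ∣ n →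
    (M : ℕ) → ∃[ p ] (M < p × Prime p × p % 4 ≡ 3 × ¬ (p ∣ n) × nGnMinusOneVanishes n p)
corollary2p6 n 4≤n (ℕ∣.divides m n≡m*2) M with prime≡3[mod4]-above (M + n)
... | p , M+n<p , prime-p , p≡3 = p , M<p , prime-p , p≡3 , p∤n , vanishes
  where
  M<p : M < p
  M<p = ℕP.≤-<-trans (ℕP.m≤m+n M n) M+n<p
  n<p : n < p
  n<p = ℕP.≤-<-trans (ℕP.m≤n+m n M) M+n<p
  p∤n : ¬ (p ∣ n)
  p∤n p∣n = ℕP.<⇒≱ n<p (ℕ∣.∣⇒≤ {{>-nonZero (ℕP.<-≤-trans z<s 4≤n)}} p∣n)
  h = suc (p / 4 * 2)
  vanishes : nGnMinusOneVanishes n p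
  vanishes = subst₂ nGnMinusOneVanishes (sym n≡m*2) (sym (p≡1+2[1+2[p/4]] p p≡3))
                    (GVanishes-if-ω̄^half≡-1 m h (suc (h * 2) ∸ 1) (omegaBar[-1]^half≡-1 (p / 4)))
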